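{- Let $H=(V,\mathcal E)$ be a hypergraph with $|V|=n$ and VC-dimension $d$. Then for every integer $k\ge d$ there exists a $k$-admissible set $V'\subset V$ with respect to $H$ of size $\Omega\!\left(n^{1-(d-1)/k}\right)$.
   Context: The VC-dimension of $H=(V,\mathcal E)$ is the maximum cardinality of a subset $V'\subseteq V$ that is shattered, i.e. $\{V'\cap r: r\in\mathcal E\}=2^{V'}$. A subset $V'\subseteq V$ is $k$-admissible if every hyperedge $S\in\mathcal E$ with $|S\cap V'|>k$ satisfies $S\cap(V\setminus V')\neq\emptyset$. -}

module Defs where

open import Data.Nat using (ℕ; _<_; _≤_)
open import Data.Fin.Subset using (Subset; _∩_; _⊆_; ∣_∣; Nonempty; ∁)
open import Data.List using (List)
open import Data.List.Membership.Propositional using (_∈_)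
open import Data.Product using (Σ; ∃-syntax; _×_)
open import Relation.Binary.PropositionalEquality using (_≡_)

Hypergraph : ℕ → Set
Hypergraph n = List (Subset n)

Shattered : ∀ {n} → Hypergraph n → Subset n → Set
Shattered {n} E V' = (T : Subset n) → T ⊆ V' → ∃[ r ] (r ∈ E × V' ∩ r ≡ T)

HasVCdim : ∀ {n} → Hypergraph n → ℕ → Set
HasVCdim {n} E d =
  (∃[ V' ] (Shattered E V' × ∣ V' ∣ ≡ d)) ×
  ((V' : Subset n) → Shattered E V' → ∣ V' ∣ ≤ d)

Admissible : ∀ {n} → Hypergraph n → ℕ → Subset n → Set
Admissible E k V' = ∀ S → S ∈ E → k < ∣ S ∩ V' ∣ → Nonempty (S ∩ ∁ V')

-- A set V is k-admissible exactly when it contains no hyperedge of size > k. By the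
-- Sauer–Shelah lemma there are at most (n+1)^d hyperedges. Keep each vertex with probability
-- 1/q and delete one vertex of every large hyperedge that survives: the result is admissible
-- and has expected size at least n/q - (n+1)^d/q^(k+1). For the least q with
-- n q^k ≥ 2 (n+1)^d this is at least n/(2q), and minimality gives q^k = O(n^(d-1)), whence
-- |V| = Ω(n^(1-(d-1)/k)). The random choice is derandomised by conditional expectations.
module Submission where

open import Defs
open import Data.Nat using (ℕ; zero; suc; pred; _≤_; _<_; _*_; _^_; _∸_; _+_; z≤n; s≤s; NonZero)
open import Data.Nat.Properties
open import Data.Nat.Tactic.RingSolver using (solve-∀)
open import Data.Bool using (Bool; true; false; _∧_; _∨_; T)
open import Data.Bool.Properties using (T-∧; T-∨) renaming (_≟_ to _≟ᵇ_)
open import Data.Fin using (zero; suc)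
open import Data.Fin.Subset using (Subset; ∣_∣; _∩_; _⊆_; ∁; Nonempty; ⊥; ⊤; inside; outside)
open import Data.Fin.Subset.Properties using (drop-∷-⊆; ∣⊥∣≡0; p∩q⊆p; p⊆q⇒∣p∣≤∣q∣)
open import Data.Vec using ([]; _∷_; here; there)
open import Data.Vec.Properties using (≡-dec)
open import Data.List.Membership.Propositional using (_∈_)
open import Data.Product using (∃-syntax; _×_; _,_; proj₁; proj₂)
open import Data.Sum using (inj₁; inj₂)
open import Data.Unit using (tt)
open import Function.Bundles using (Equivalence)
open import Relation.Nullary using (¬_; Dec; yes; no; contradiction)
open import Relation.Nullary.Decidable using (isYes; _×-dec_; toWitness; fromWitness)
open import Relation.Unary using (Decidable)
open import Relation.Binary.PropositionalEquality using (_≡_; _≢_; refl; sym; trans; cong; cong₂; subst; module ≡-Reasoning)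

∑⊆ : ∀ {n} → Subset n → (Subset n → ℕ) → ℕ
∑⊆ []             F = F []
∑⊆ (outside ∷ A) F = ∑⊆ A (λ S → F (outside ∷ S))
∑⊆ (inside  ∷ A) F = ∑⊆ A (λ S → F (outside ∷ S) + F (inside ∷ S))

∑⊆-cong : ∀ {n} (A : Subset n) {F G : Subset n → ℕ} → (∀ S → F S ≡ G S) → ∑⊆ A F ≡ ∑⊆ A G
∑⊆-cong []            F≡G = F≡G []
∑⊆-cong (outside ∷ A) F≡G = ∑⊆-cong A (λ S → F≡G (outside ∷ S))
∑⊆-cong (inside  ∷ A) F≡G = ∑⊆-cong A (λ S → cong₂ _+_ (F≡G (outside ∷ S)) (F≡G (inside ∷ S)))

∑⊆-+ : ∀ {n} (A : Subset n) (F G : Subset n → ℕ) → ∑⊆ A (λ S → F S + G S) ≡ ∑⊆ A F + ∑⊆ A G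
∑⊆-+ []            F G = refl
∑⊆-+ (outside ∷ A) F G = ∑⊆-+ A _ _
∑⊆-+ (inside  ∷ A) F G = begin
  ∑⊆ A (λ S → (F (outside ∷ S) + G (outside ∷ S)) + (F (inside ∷ S) + G (inside ∷ S)))
    ≡⟨ ∑⊆-cong A (λ S → +-+-exchange (F (outside ∷ S)) _ _ _) ⟩
  ∑⊆ A (λ S → (F (outside ∷ S) + F (inside ∷ S)) + (G (outside ∷ S) + G (inside ∷ S)))
    ≡⟨ ∑⊆-+ A _ _ ⟩
  ∑⊆ A (λ S → F (outside ∷ S) + F (inside ∷ S)) + ∑⊆ A (λ S → G (outside ∷ S) + G (inside ∷ S)) ∎
  where
  open ≡-Reasoning
  +-+-exchange : ∀ a b c d → (a + b) + (c + d) ≡ (a + c) + (b + d)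
  +-+-exchange = solve-∀

∑⊆-⊥ : ∀ {n} (A : Subset n) (F : Subset n → ℕ) → F ⊥ ≤ ∑⊆ A F
∑⊆-⊥ []            F = ≤-refl
∑⊆-⊥ (outside ∷ A) F = ∑⊆-⊥ A _
∑⊆-⊥ (inside  ∷ A) F = ≤-trans (m≤m+n (F ⊥) _) (∑⊆-⊥ A _)

𝟙 : Bool → ℕ
𝟙 true  = 1
𝟙 false = 0

𝟙-∨-∧ : ∀ x y → 𝟙 x + 𝟙 y ≡ 𝟙 (x ∨ y) + 𝟙 (x ∧ y)
𝟙-∨-∧ true  true  = refl
𝟙-∨-∧ true  false = refl
𝟙-∨-∧ false true  = refl
𝟙-∨-∧ false false = refl

𝟙≤1 : ∀ x → 𝟙 x ≤ 1
𝟙≤1 true  = ≤-refl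
𝟙≤1 false = z≤n

𝟙>0⇒T : ∀ x → 0 < 𝟙 x → T x
𝟙>0⇒T true _ = tt

T⇒𝟙>0 : ∀ x → T x → 0 < 𝟙 x
T⇒𝟙>0 true _ = s≤s z≤n

Shatters : ∀ {n} → (Subset n → Bool) → Subset n → Set
Shatters P Y = ∀ Z → Z ⊆ Y → ∃[ r ] (T (P r) × Y ∩ r ≡ Z)

shatters-∨ : ∀ {n} (P : Subset (suc n) → Bool) {Y} →
  Shatters (λ S → P (outside ∷ S) ∨ P (inside ∷ S)) Y → Shatters P (outside ∷ Y)
shatters-∨ P sh (inside  ∷ Z) Z⊆Y with () ← Z⊆Y here
shatters-∨ P sh (outside ∷ Z) Z⊆Y with sh Z (drop-∷-⊆ Z⊆Y)
... | r , Pr , Y∩r≡Z with Equivalence.to T-∨ Pr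
...   | inj₁ P₀r = outside ∷ r , P₀r , cong (outside ∷_) Y∩r≡Z
...   | inj₂ P₁r = inside  ∷ r , P₁r , cong (outside ∷_) Y∩r≡Z

shatters-∧ : ∀ {n} (P : Subset (suc n) → Bool) {Y} →
  Shatters (λ S → P (outside ∷ S) ∧ P (inside ∷ S)) Y → Shatters P (inside ∷ Y)
shatters-∧ P sh (s ∷ Z) Z⊆Y with sh Z (drop-∷-⊆ Z⊆Y)
... | r , Pr , Y∩r≡Z = s ∷ r , either s (Equivalence.to T-∧ Pr) , cong (s ∷_) Y∩r≡Z
  where
  either : ∀ s → T (P (outside ∷ r)) × T (P (inside ∷ r)) → T (P (s ∷ r))
  either outside = proj₁
  either inside  = proj₂

-- Φ n d = Σ_{i<d} (n choose i); the recursion is Pascal's rule.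
Φ : ℕ → ℕ → ℕ
Φ _       zero    = 0
Φ zero    (suc d) = 1
Φ (suc n) (suc d) = Φ n (suc d) + Φ n d

Φ-pascal : ∀ n d → Φ n d + Φ n (pred d) ≡ Φ (suc n) d
Φ-pascal n zero    = refl
Φ-pascal n (suc d) = refl

sauer-shelah : ∀ {n} d (P : Subset n → Bool) → (∀ Y → Shatters P Y → ∣ Y ∣ < d) →
  ∑⊆ ⊤ (λ S → 𝟙 (P S)) ≤ Φ n d
sauer-shelah {zero} zero P small with P [] in P[]
... | false = z≤n
... | true  = contradiction (small [] λ { [] _ → [] , subst T (sym P[]) tt , refl }) λ ()
sauer-shelah {zero} (suc d) P small = 𝟙≤1 (P [])
sauer-shelah {suc n} d P small = begin
  ∑⊆ ⊤ (λ S → 𝟙 (P (outside ∷ S)) + 𝟙 (P (inside ∷ S)))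
    ≡⟨ ∑⊆-cong ⊤ (λ S → 𝟙-∨-∧ (P (outside ∷ S)) (P (inside ∷ S))) ⟩
  ∑⊆ ⊤ (λ S → 𝟙 (P∨ S) + 𝟙 (P∧ S))
    ≡⟨ ∑⊆-+ ⊤ (λ S → 𝟙 (P∨ S)) (λ S → 𝟙 (P∧ S)) ⟩
  ∑⊆ ⊤ (λ S → 𝟙 (P∨ S)) + ∑⊆ ⊤ (λ S → 𝟙 (P∧ S))
    ≤⟨ +-mono-≤ (sauer-shelah d P∨ λ Y sh → small (outside ∷ Y) (shatters-∨ P sh))
                (sauer-shelah (pred d) P∧ λ Y sh → pred-mono-≤ (small (inside ∷ Y) (shatters-∧ P sh))) ⟩
  Φ n d + Φ n (pred d)
    ≡⟨ Φ-pascal n d ⟩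
  Φ (suc n) d ∎
  where
  open ≤-Reasoning
  P∨ P∧ : Subset n → Bool
  P∨ S = P (outside ∷ S) ∨ P (inside ∷ S)
  P∧ S = P (outside ∷ S) ∧ P (inside ∷ S)

Φ-bound : ∀ n d → Φ n (suc d) ≤ suc n ^ d
Φ-bound zero    d       = ≤-reflexive (sym (^-zeroˡ d))
Φ-bound (suc n) zero    rewrite +-identityʳ (Φ n 1) = Φ-bound n zero
Φ-bound (suc n) (suc d) = begin
  Φ n (suc (suc d)) + Φ n (suc d)     ≤⟨ +-mono-≤ (Φ-bound n (suc d)) (Φ-bound n d) ⟩
  suc n * suc n ^ d + suc n ^ d       ≡⟨ +-comm (suc n * suc n ^ d) _ ⟩
  suc (suc n) * suc n ^ d             ≤⟨ *-monoʳ-≤ (suc (suc n)) (^-monoˡ-≤ d (n≤1+n (suc n))) ⟩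
  suc (suc n) * suc (suc n) ^ d       ∎
  where open ≤-Reasoning

-- ∑ʷ q F = Σ_S q^(n - |S|) F S: q^n times the expected F-mass of the subsets of a random
-- set that contains each point independently with probability 1/q.
∑ʷ : ∀ {n} → ℕ → (Subset n → ℕ) → ℕ
∑ʷ {zero}  q F = F []
∑ʷ {suc n} q F = q * ∑ʷ q (λ S → F (outside ∷ S)) + ∑ʷ q (λ S → F (inside ∷ S))

∑ʷ-+ : ∀ {n} q (F G : Subset n → ℕ) → ∑ʷ q (λ S → F S + G S) ≡ ∑ʷ q F + ∑ʷ q G
∑ʷ-+ {zero}  q F G = refl
∑ʷ-+ {suc n} q F G
  rewrite ∑ʷ-+ q (λ S → F (outside ∷ S)) (λ S → G (outside ∷ S))
        | ∑ʷ-+ q (λ S → F (inside ∷ S)) (λ S → G (inside ∷ S))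
  = distrib q _ _ _ _
  where
  distrib : ∀ q a b c d → q * (a + b) + (c + d) ≡ (q * a + c) + (q * b + d)
  distrib = solve-∀

private
  unfold-step : ∀ q n Q I → suc n * (q * Q) + q * (q * Q) * I ≡ q * (n * Q + q * Q * I) + q * Q
  unfold-step = solve-∀

  include-step : ∀ q .{{_ : NonZero q}} {n Q I a W₀ W₁} → W₁ ≤ Q →
    n * Q + q * Q * I ≤ q * Q * a + q * (W₀ + W₁) →
    suc n * (q * Q) + q * (q * Q) * I ≤ q * (q * Q) * suc a + q * (q * W₀ + W₁)
  include-step q@(suc p) {n} {Q} {I} {a} {W₀} {W₁} W₁≤Q sampled = begin
    suc n * (q * Q) + q * (q * Q) * I             ≡⟨ unfold-step q n Q I ⟩
    q * (n * Q + q * Q * I) + q * Q               ≤⟨ +-monoˡ-≤ (q * Q) (*-monoʳ-≤ q sampled) ⟩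
    q * (q * Q * a + q * (W₀ + W₁)) + q * Q       ≡⟨ e₁ p Q a W₀ W₁ ⟩
    q * (q * Q * a + q * W₀ + W₁) + q * (p * W₁ + Q)
      ≤⟨ +-monoʳ-≤ (q * (q * Q * a + q * W₀ + W₁)) (*-monoʳ-≤ q (+-monoˡ-≤ Q (*-monoʳ-≤ p W₁≤Q))) ⟩
    q * (q * Q * a + q * W₀ + W₁) + q * (p * Q + Q) ≡⟨ e₂ p Q a W₀ W₁ ⟩
    q * (q * Q) * suc a + q * (q * W₀ + W₁)       ∎
    where
    open ≤-Reasoning
    e₁ : ∀ p Q a W₀ W₁ → suc p * (suc p * Q * a + suc p * (W₀ + W₁)) + suc p * Q
                       ≡ suc p * (suc p * Q * a + suc p * W₀ + W₁) + suc p * (p * W₁ + Q)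
    e₁ = solve-∀
    e₂ : ∀ p Q a W₀ W₁ → suc p * (suc p * Q * a + suc p * W₀ + W₁) + suc p * (p * Q + Q)
                       ≡ suc p * (suc p * Q) * suc a + suc p * (suc p * W₀ + W₁)
    e₂ = solve-∀

  exclude-step : ∀ q {n Q I a W₀ W₁} → Q ≤ W₁ →
    n * Q + q * Q * I ≤ q * Q * a + q * W₀ →
    suc n * (q * Q) + q * (q * Q) * I ≤ q * (q * Q) * a + q * (q * W₀ + W₁)
  exclude-step q {n} {Q} {I} {a} {W₀} {W₁} Q≤W₁ sampled = begin
    suc n * (q * Q) + q * (q * Q) * I             ≡⟨ unfold-step q n Q I ⟩
    q * (n * Q + q * Q * I) + q * Q               ≤⟨ +-mono-≤ (*-monoʳ-≤ q sampled) (*-monoʳ-≤ q Q≤W₁) ⟩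
    q * (q * Q * a + q * W₀) + q * W₁             ≡⟨ regroup q Q a W₀ W₁ ⟩
    q * (q * Q) * a + q * (q * W₀ + W₁)           ∎
    where
    open ≤-Reasoning
    regroup : ∀ q Q a W₀ W₁ → q * (q * Q * a + q * W₀) + q * W₁ ≡ q * (q * Q) * a + q * (q * W₀ + W₁)
    regroup = solve-∀

-- Conditional expectations: fixing the points one at a time, each choice keeps
-- |A| - ∑⊆ A F at least its expected value n/q - ∑ʷ q F / q^n.
sample-beats-expectation : ∀ {n} q .{{_ : NonZero q}} (F : Subset n → ℕ) →
  ∃[ A ] (n * q ^ n + q ^ suc n * ∑⊆ A F ≤ q ^ suc n * ∣ A ∣ + q * ∑ʷ q F)
sample-beats-expectation {zero} q F = [] , ≤-reflexive (empty q (F []))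
  where
  empty : ∀ q x → 0 * 1 + q * 1 * x ≡ q * 1 * 0 + q * x
  empty = solve-∀
sample-beats-expectation {suc n} q F with ∑ʷ q (λ S → F (inside ∷ S)) ≤? q ^ n
... | yes W₁≤Q =
  let F₀ = λ S → F (outside ∷ S); F₁ = λ S → F (inside ∷ S)
      A , sampled = sample-beats-expectation q (λ S → F₀ S + F₁ S)
      split = cong (λ W → q ^ suc n * ∣ A ∣ + q * W) (∑ʷ-+ q F₀ F₁)
  in inside ∷ A , include-step q {n} W₁≤Q (≤-trans sampled (≤-reflexive split))
... | no W₁≰Q =
  let A , sampled = sample-beats-expectation q (λ S → F (outside ∷ S))
  in outside ∷ A , exclude-step q {n} (<⇒≤ (≰⇒> W₁≰Q)) sampled

Independent : ∀ {n} → (Subset n → ℕ) → Subset n → Set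
Independent F V = ∀ S → 0 < F S → Nonempty (S ∩ ∁ V)

private
  nonempty-∷ : ∀ {n b} {X : Subset n} → Nonempty X → Nonempty (b ∷ X)
  nonempty-∷ (x , x∈X) = suc x , there x∈X

  independent-outside : ∀ {n} {F : Subset (suc n) → ℕ} {V} →
    Independent (λ S → F (outside ∷ S)) V → Independent F (outside ∷ V)
  independent-outside indep (inside  ∷ S) _   = zero , here
  independent-outside indep (outside ∷ S) pos = nonempty-∷ (indep S pos)

  independent-inside : ∀ {n} {F : Subset (suc n) → ℕ} {V} →
    Independent (λ S → F (outside ∷ S) + F (inside ∷ S)) V → Independent F (inside ∷ V)
  independent-inside indep (outside ∷ S) pos = nonempty-∷ (indep S (<-≤-trans pos (m≤m+n _ _)))
  independent-inside indep (inside  ∷ S) pos = nonempty-∷ (indep S (<-≤-trans pos (m≤n+m _ _)))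

-- Each deleted point is charged to a positive set inside A through it, distinct deletions
-- to distinct sets.
independent-subset : ∀ {n} (F : Subset n → ℕ) → F ⊥ ≡ 0 → ∀ A →
  ∃[ V ] (Independent F V × ∣ A ∣ ≤ ∣ V ∣ + ∑⊆ A F)
independent-subset F F⊥≡0 [] = [] , (λ { [] pos → contradiction (sym F⊥≡0) (<⇒≢ pos) }) , z≤n
independent-subset F F⊥≡0 (outside ∷ A) =
  let V , indep , size = independent-subset (λ S → F (outside ∷ S)) F⊥≡0 A
  in outside ∷ V , independent-outside indep , size
independent-subset F F⊥≡0 (inside ∷ A) with ∑⊆ A (λ S → F (inside ∷ S)) ≟ 0
... | yes none =
  let V , indep , size = independent-subset F₀₁ F₀₁⊥≡0 A
  in inside ∷ V , independent-inside indep , s≤s size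
  where
  F₀₁ : _ → ℕ
  F₀₁ S = F (outside ∷ S) + F (inside ∷ S)
  F₀₁⊥≡0 : F₀₁ ⊥ ≡ 0
  F₀₁⊥≡0 rewrite F⊥≡0 = n≤0⇒n≡0 (subst (F (inside ∷ ⊥) ≤_) none (∑⊆-⊥ A (λ S → F (inside ∷ S))))
... | no some =
  let V , indep , size = independent-subset (λ S → F (outside ∷ S)) F⊥≡0 A
      F₀ = λ S → F (outside ∷ S); F₁ = λ S → F (inside ∷ S)
      regroup = trans (+-assoc ∣ V ∣ _ _) (cong (∣ V ∣ +_) (sym (∑⊆-+ A F₀ F₁)))
  in outside ∷ V , independent-outside indep , ≤-trans (absorb size some) (≤-reflexive regroup)
  where
  absorb : ∀ {a b s} → a ≤ b → s ≢ 0 → suc a ≤ b + s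
  absorb {a} {b} {s} a≤b s≢0 = subst (_≤ b + s) (+-comm a 1) (+-mono-≤ a≤b (n≢0⇒n>0 s≢0))

∑ʷ-bound : ∀ {n} q .{{_ : NonZero q}} m (F : Subset n → ℕ) → (∀ S → 0 < F S → m ≤ ∣ S ∣) →
  q ^ m * ∑ʷ q F ≤ q ^ n * ∑⊆ ⊤ F
∑ʷ-bound {zero} q zero    F support = ≤-refl
∑ʷ-bound {zero} q (suc m) F support with F [] in F[]
... | zero  = ≤-reflexive (*-zeroʳ (q ^ suc m))
... | suc _ with () ← support [] (subst (0 <_) (sym F[]) (s≤s z≤n))
∑ʷ-bound {suc n} q m F support = begin
  q ^ m * (q * W₀ + W₁)                     ≡⟨ *-distribˡ-+ (q ^ m) (q * W₀) W₁ ⟩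
  q ^ m * (q * W₀) + q ^ m * W₁             ≤⟨ +-monoʳ-≤ (q ^ m * (q * W₀)) (*-monoˡ-≤ W₁ (^-pred m)) ⟩
  q ^ m * (q * W₀) + q * q ^ pred m * W₁    ≡⟨ regroup q (q ^ m) (q ^ pred m) W₀ W₁ ⟩
  q * (q ^ m * W₀) + q * (q ^ pred m * W₁)
    ≤⟨ +-mono-≤ (*-monoʳ-≤ q (∑ʷ-bound q m F₀ λ S → support (outside ∷ S)))
                (*-monoʳ-≤ q (∑ʷ-bound q (pred m) F₁ λ S pos → pred-mono-≤ (support (inside ∷ S) pos))) ⟩
  q * (q ^ n * ∑⊆ ⊤ F₀) + q * (q ^ n * ∑⊆ ⊤ F₁)   ≡⟨ factor q (q ^ n) (∑⊆ ⊤ F₀) (∑⊆ ⊤ F₁) ⟩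
  q * q ^ n * (∑⊆ ⊤ F₀ + ∑⊆ ⊤ F₁)              ≡⟨ cong (q * q ^ n *_) (∑⊆-+ ⊤ F₀ F₁) ⟨
  q ^ suc n * ∑⊆ ⊤ F                          ∎
  where
  open ≤-Reasoning
  F₀ F₁ : Subset n → ℕ
  F₀ S = F (outside ∷ S)
  F₁ S = F (inside ∷ S)
  W₀ = ∑ʷ q F₀
  W₁ = ∑ʷ q F₁
  ^-pred : ∀ m → q ^ m ≤ q * q ^ pred m
  ^-pred zero    = m≤n*m 1 q
  ^-pred (suc m) = ≤-refl
  regroup : ∀ q X Y W₀ W₁ → X * (q * W₀) + q * Y * W₁ ≡ q * (X * W₀) + q * (Y * W₁)
  regroup = solve-∀
  factor : ∀ q Q C₀ C₁ → q * (Q * C₀) + q * (Q * C₁) ≡ q * Q * (C₀ + C₁)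
  factor = solve-∀

private
  deletion-arithmetic : ∀ q Q K .{{_ : NonZero q}} .{{_ : NonZero Q}} {n I a v W N} →
    n * Q + q * Q * I ≤ q * Q * a + q * W → a ≤ v + I → q * K * W ≤ Q * N →
    n * K ≤ q * K * v + N
  deletion-arithmetic q Q K {n} {I} {a} {v} {W} {N} sampled deleted weighted =
    *-cancelˡ-≤ (q * Q) {{m*n≢0 q Q}} (begin
      q * Q * (n * K)                ≡⟨ e₁ q Q K n ⟩
      q * K * (n * Q)                ≤⟨ *-monoʳ-≤ (q * K) kept ⟩
      q * K * (q * Q * v + q * W)    ≡⟨ e₂ q Q K v W ⟩
      q * Q * (q * K * v) + q * (q * K * W) ≤⟨ +-monoʳ-≤ (q * Q * (q * K * v)) (*-monoʳ-≤ q weighted) ⟩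
      q * Q * (q * K * v) + q * (Q * N)     ≡⟨ e₃ q Q K v N ⟩
      q * Q * (q * K * v + N)        ∎)
    where
    open ≤-Reasoning
    e₁ : ∀ q Q K n → q * Q * (n * K) ≡ q * K * (n * Q)
    e₁ = solve-∀
    e₂ : ∀ q Q K v W → q * K * (q * Q * v + q * W) ≡ q * Q * (q * K * v) + q * (q * K * W)
    e₂ = solve-∀
    e₃ : ∀ q Q K v N → q * Q * (q * K * v) + q * (Q * N) ≡ q * Q * (q * K * v + N)
    e₃ = solve-∀
    e₄ : ∀ q Q v I W → q * Q * (v + I) + q * W ≡ q * Q * v + q * W + q * Q * I
    e₄ = solve-∀
    kept : n * Q ≤ q * Q * v + q * W
    kept = +-cancelʳ-≤ (q * Q * I) _ _ (begin
      n * Q + q * Q * I               ≤⟨ sampled ⟩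
      q * Q * a + q * W               ≤⟨ +-monoˡ-≤ (q * W) (*-monoʳ-≤ (q * Q) deleted) ⟩
      q * Q * (v + I) + q * W         ≡⟨ e₄ q Q v I W ⟩
      q * Q * v + q * W + q * Q * I   ∎)

deletion-bound : ∀ {n} k q .{{_ : NonZero q}} (F : Subset n → ℕ) → (∀ S → 0 < F S → k < ∣ S ∣) →
  ∃[ V ] (Independent F V × n * q ^ k ≤ q ^ suc k * ∣ V ∣ + ∑⊆ ⊤ F)
deletion-bound {n} k q F support =
  let A , sampled = sample-beats-expectation q F
      V , indep , deleted = independent-subset F F⊥≡0 A
  in V , indep , deletion-arithmetic q (q ^ n) (q ^ k) {n}
                   sampled deleted (∑ʷ-bound q (suc k) F support)
  where
  instance
    q^n≢0 : NonZero (q ^ n)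
    q^n≢0 = m^n≢0 q n
  F⊥≡0 : F ⊥ ≡ 0
  F⊥≡0 = n≤0⇒n≡0 (≮⇒≥ λ pos → n≮0 (subst (k <_) (∣⊥∣≡0 n) (support ⊥ pos)))

crossing : (G : ℕ → Set) → Decidable G → ¬ G 0 → ∀ b → G b → ∃[ p ] (¬ G p × G (suc p))
crossing G G? ¬G0 zero    Gb = contradiction Gb ¬G0
crossing G G? ¬G0 (suc b) Gb with G? b
... | yes Gb′ = crossing G G? ¬G0 b Gb′
... | no ¬Gb  = b , ¬Gb , Gb

^-distribʳ-* : ∀ m n o → (m * n) ^ o ≡ m ^ o * n ^ o
^-distribʳ-* m n zero    = refl
^-distribʳ-* m n (suc o) = begin
  m * n * (m * n) ^ o        ≡⟨ cong (m * n *_) (^-distribʳ-* m n o) ⟩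
  m * n * (m ^ o * n ^ o)    ≡⟨ swap m n (m ^ o) (n ^ o) ⟩
  m * m ^ o * (n * n ^ o)    ∎
  where
  open ≡-Reasoning
  swap : ∀ a b c d → a * b * (c * d) ≡ a * c * (b * d)
  swap = solve-∀

m≤m^n : ∀ m .{{_ : NonZero m}} {n} → 1 ≤ n → m ≤ m ^ n
m≤m^n m {n} 1≤n = subst (_≤ m ^ n) (*-identityʳ m) (^-monoʳ-≤ m 1≤n)

half-survives : ∀ K .{{_ : NonZero K}} {n q v N} → n * K ≤ q * K * v + N → 2 * N ≤ n * K →
  n ≤ 2 * q * v
half-survives K {n} {q} {v} {N} bound 2N≤nK = *-cancelʳ-≤ n (2 * q * v) K (begin
  n * K                          ≤⟨ +-cancelʳ-≤ (n * K) _ _ doubled ⟩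
  2 * (q * K * v)                ≡⟨ regroup q K v ⟩
  2 * q * v * K                  ∎)
  where
  open ≤-Reasoning
  regroup : ∀ q K v → 2 * (q * K * v) ≡ 2 * q * v * K
  regroup = solve-∀
  doubled : n * K + n * K ≤ 2 * (q * K * v) + n * K
  doubled = begin
    n * K + n * K                ≡⟨ cong (n * K +_) (+-identityʳ (n * K)) ⟨
    2 * (n * K)                  ≤⟨ *-monoʳ-≤ 2 bound ⟩
    2 * (q * K * v + N)          ≡⟨ *-distribˡ-+ 2 (q * K * v) N ⟩
    2 * (q * K * v) + 2 * N      ≤⟨ +-monoʳ-≤ (2 * (q * K * v)) 2N≤nK ⟩
    2 * (q * K * v) + n * K      ∎

minimal-q-bound : ∀ {n d k q r v} → 1 ≤ n → 1 ≤ d → d ≤ k → q ≤ r + r →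
  n ≤ 2 * q * v → n * r ^ k ≤ 2 * suc n ^ d →
  n ^ (suc k ∸ d) ≤ (2 ^ (3 + d) * v) ^ k
minimal-q-bound {n@(suc _)} {d} {k} {q} {r} {v} _ 1≤d d≤k q≤2r n≤2qv nr^k≤2R =
  *-cancelʳ-≤ (n ^ (suc k ∸ d)) ((2 ^ (3 + d) * v) ^ k) (n ^ d) {{m^n≢0 n d}} (begin
    n ^ (suc k ∸ d) * n ^ d                  ≡⟨ ^-distribˡ-+-* n (suc k ∸ d) d ⟨
    n ^ (suc k ∸ d + d)                      ≡⟨ cong (n ^_) (m∸n+n≡m (m≤n⇒m≤1+n d≤k)) ⟩
    n * n ^ k                                ≤⟨ *-monoʳ-≤ n (^-monoˡ-≤ k n≤4vr) ⟩
    n * (4 * v * r) ^ k                      ≡⟨ cong (n *_) (^-distribʳ-* (4 * v) r k) ⟩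
    n * ((4 * v) ^ k * r ^ k)                ≡⟨ swap n ((4 * v) ^ k) (r ^ k) ⟩
    (4 * v) ^ k * (n * r ^ k)                ≤⟨ *-monoʳ-≤ ((4 * v) ^ k) (≤-trans nr^k≤2R 2R≤) ⟩
    (4 * v) ^ k * ((2 ^ suc d) ^ k * n ^ d)  ≡⟨ *-assoc ((4 * v) ^ k) _ (n ^ d) ⟨
    (4 * v) ^ k * (2 ^ suc d) ^ k * n ^ d    ≡⟨ cong (_* n ^ d) (^-distribʳ-* (4 * v) (2 ^ suc d) k) ⟨
    (4 * v * 2 ^ suc d) ^ k * n ^ d          ≡⟨ cong (λ x → x ^ k * n ^ d) (constant v (2 ^ d)) ⟩
    (2 ^ (3 + d) * v) ^ k * n ^ d            ∎)
  where
  open ≤-Reasoning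
  swap : ∀ n a b → n * (a * b) ≡ a * (n * b)
  swap = solve-∀
  constant : ∀ v e → 4 * v * (2 * e) ≡ 2 * (2 * (2 * e)) * v
  constant = solve-∀
  n≤4vr : n ≤ 4 * v * r
  n≤4vr = begin
    n               ≤⟨ n≤2qv ⟩
    2 * q * v       ≤⟨ *-monoˡ-≤ v (*-monoʳ-≤ 2 q≤2r) ⟩
    2 * (r + r) * v ≡⟨ regroup r v ⟩
    4 * v * r       ∎
    where
    regroup : ∀ r v → 2 * (r + r) * v ≡ 4 * v * r
    regroup = solve-∀
  2R≤ : 2 * suc n ^ d ≤ (2 ^ suc d) ^ k * n ^ d
  2R≤ = begin
    2 * suc n ^ d         ≤⟨ *-monoʳ-≤ 2 (^-monoˡ-≤ d (+-monoˡ-≤ n (s≤s z≤n))) ⟩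
    2 * (n + n) ^ d       ≡⟨ cong (λ m → 2 * m ^ d) (cong (n +_) (+-identityʳ n)) ⟨
    2 * (2 * n) ^ d       ≡⟨ cong (2 *_) (^-distribʳ-* 2 n d) ⟩
    2 * (2 ^ d * n ^ d)   ≡⟨ *-assoc 2 (2 ^ d) (n ^ d) ⟨
    2 ^ suc d * n ^ d     ≤⟨ *-monoˡ-≤ (n ^ d) (m≤m^n (2 ^ suc d) {{m^n≢0 2 (suc d)}} (≤-trans 1≤d d≤k)) ⟩
    (2 ^ suc d) ^ k * n ^ d ∎

-- q = p + 2 is the least integer with 2 (n+1)^d ≤ n q^k: G (q - 1) holds, G (q - 2) fails.
independent-set-bound : ∀ {n} d k (F : Subset n → ℕ) → 1 ≤ d → d ≤ k →
  (∀ S → 0 < F S → k < ∣ S ∣) → ∑⊆ ⊤ F ≤ suc n ^ d →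
  ∃[ V ] (Independent F V × n ^ (suc k ∸ d) ≤ (2 ^ (3 + d) * ∣ V ∣) ^ k)
independent-set-bound {zero} d k F _ d≤k large _ =
  [] , (λ { [] pos → contradiction (large [] pos) λ () }) ,
  subst (λ e → 0 ^ e ≤ (2 ^ (3 + d) * 0) ^ k) (sym (+-∸-assoc 1 d≤k)) z≤n
independent-set-bound {n@(suc _)} d k F 1≤d d≤k large #F≤R =
  let p , ¬G[p] , G[1+p] = crossing G (λ m → 2 * R ≤? n * suc m ^ k) ¬G[0] (2 * R) G[2R]
      q = suc (suc p)
      V , independent , bound = deletion-bound k q F large
      enough = half-survives (q ^ k) {{m^n≢0 q k}} {n} {q} {∣ V ∣}
                 (≤-trans bound (+-monoʳ-≤ (q ^ suc k * ∣ V ∣) #F≤R)) G[1+p]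
  in V , independent ,
     minimal-q-bound (s≤s z≤n) 1≤d d≤k (s≤s (m≤n+m (suc p) p)) enough (<⇒≤ (≰⇒> ¬G[p]))
  where
  R = suc n ^ d

  G : ℕ → Set
  G m = 2 * R ≤ n * suc m ^ k

  ¬G[0] : ¬ G 0
  ¬G[0] G[0] = <-irrefl refl (begin-strict
    n           <⟨ n<1+n n ⟩
    suc n       ≤⟨ m≤m^n (suc n) 1≤d ⟩
    R           ≤⟨ m≤m+n R (R + 0) ⟩
    2 * R       ≤⟨ G[0] ⟩
    n * 1 ^ k   ≡⟨ cong (n *_) (^-zeroˡ k) ⟩
    n * 1       ≡⟨ *-identityʳ n ⟩
    n           ∎)
    where open ≤-Reasoning

  G[2R] : G (2 * R)
  G[2R] = ≤-trans (n≤1+n (2 * R)) (≤-trans (m≤m^n (suc (2 * R)) (≤-trans 1≤d d≤k)) (m≤n*m _ n))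

admissible-set : ∀ {n} d k (E : Hypergraph n) → 1 ≤ d → d ≤ k →
  (∀ Y → Shattered E Y → ∣ Y ∣ ≤ d) →
  ∃[ V ] (Admissible E k V × n ^ (suc k ∸ d) ≤ (2 ^ (3 + d) * ∣ V ∣) ^ k)
admissible-set {n} d k E 1≤d d≤k vc≤d =
  let V , independent , bound = independent-set-bound d k F 1≤d d≤k large #large≤R
  in V , admissible independent , bound
  where
  open import Data.List.Membership.DecPropositional (≡-dec {n = n} _≟ᵇ_) using (_∈?_)

  large? : (S : Subset n) → Dec (S ∈ E × k < ∣ S ∣)
  large? S = S ∈? E ×-dec k <? ∣ S ∣

  F : Subset n → ℕ
  F S = 𝟙 (isYes (large? S))

  large : ∀ S → 0 < F S → k < ∣ S ∣
  large S pos = proj₂ (toWitness (𝟙>0⇒T _ pos))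

  admissible : ∀ {V} → Independent F V → Admissible E k V
  admissible independent S S∈E k<∣S∩V∣ =
    independent S (T⇒𝟙>0 _ (fromWitness (S∈E , <-≤-trans k<∣S∩V∣ (p⊆q⇒∣p∣≤∣q∣ (p∩q⊆p S _)))))

  shattered : ∀ {Y} → Shatters (λ S → isYes (large? S)) Y → Shattered E Y
  shattered sh Z Z⊆Y = let r , large[r] , Y∩r≡Z = sh Z Z⊆Y in r , proj₁ (toWitness large[r]) , Y∩r≡Z

  #large≤R : ∑⊆ ⊤ F ≤ suc n ^ d
  #large≤R = ≤-trans (sauer-shelah (suc d) (λ S → isYes (large? S)) λ Y sh → s≤s (vc≤d Y (shattered sh)))
                     (Φ-bound n d)

mainTheorem5 : (d k : ℕ) → 1 ≤ d → d ≤ k →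
    ∃[ C ] (1 ≤ C × ((n : ℕ) (E : Hypergraph n) → HasVCdim E d →
    ∃[ V' ] (Admissible E k V' × n ^ (suc k ∸ d) ≤ (C * ∣ V' ∣) ^ k)))
mainTheorem5 d k 1≤d d≤k =
  2 ^ (3 + d) , m^n>0 2 (3 + d) , λ n E vc-dim → admissible-set d k E 1≤d d≤k (proj₂ vc-dim)
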